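{- Let $\mathcal U$ be a quasi-selective ultrafilter on $\mathbb N$ and let $f:\mathbb N\to\mathbb N$ be nondecreasing. Then the following are equivalent: (i) for every function $g:\mathbb N\to\mathbb N$ with $g\le f$ (pointwise) there exists a nondecreasing function $h$ with $h\equiv_{\mathcal U} g$; (ii) there exists a set $U=\{u_n: n\in\mathbb N\}\in\mathcal U$, enumerated increasingly ($u_0<u_1<\cdots$), such that $f(u_n)<u_{n+1}-u_n$ for all $n$.
   Context: $\mathbb N=\{0,1,2,\dots\}$. $f\equiv_{\mathcal U}g$ means $\{n: f(n)=g(n)\}\in\mathcal U$. A nonprincipal ultrafilter $\mathcal U$ on $\mathbb N$ is quasi-selective if every $f:\mathbb N\to\mathbb N$ with $f(n)\le n$ for all $n$ is $\mathcal U$-equivalent to a nondecreasing function. -}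

module Defs where

open import Data.Nat using (ℕ; suc; _≤_; _<_; _∸_)
open import Data.Product using (Σ; ∃; _×_; _,_)
open import Data.Sum using (_⊎_)
open import Data.Empty using (⊥)
open import Data.Unit using (⊤)
open import Relation.Nullary using (¬_)
open import Relation.Binary.PropositionalEquality using (_≡_)

-- Subsets of ℕ are predicates ℕ → Set; a family of sets is (ℕ → Set) → Set.
Family : Set₁
Family = (ℕ → Set) → Set

record IsUltrafilter (𝒰 : Family) : Set₁ where
  field
    full    : 𝒰 (λ _ → ⊤)
    empty∉  : ¬ 𝒰 (λ _ → ⊥)
    upward  : ∀ (A B : ℕ → Set) → 𝒰 A → (∀ n → A n → B n) → 𝒰 B
    inter   : ∀ (A B : ℕ → Set) → 𝒰 A → 𝒰 B → 𝒰 (λ n → A n × B n)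
    ultra   : ∀ (A : ℕ → Set) → 𝒰 A ⊎ 𝒰 (λ n → ¬ A n)

IsNonprincipal : Family → Set
IsNonprincipal 𝒰 = ∀ k → ¬ 𝒰 (λ n → n ≡ k)

Nondecreasing : (ℕ → ℕ) → Set
Nondecreasing f = ∀ m n → m ≤ n → f m ≤ f n

_≡[_]_ : (ℕ → ℕ) → Family → (ℕ → ℕ) → Set
f ≡[ 𝒰 ] g = 𝒰 (λ n → f n ≡ g n)

record IsQuasiSelective (𝒰 : Family) : Set₁ where
  field
    ultrafilter  : IsUltrafilter 𝒰
    nonprincipal : IsNonprincipal 𝒰
    quasiSel     : ∀ (f : ℕ → ℕ) → (∀ n → f n ≤ n) →
                   Σ (ℕ → ℕ) (λ h → Nondecreasing h × (f ≡[ 𝒰 ] h))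

CondI : Family → (ℕ → ℕ) → Set
CondI 𝒰 f = ∀ (g : ℕ → ℕ) → (∀ n → g n ≤ f n) →
            Σ (ℕ → ℕ) (λ h → Nondecreasing h × (h ≡[ 𝒰 ] g))

CondII : Family → (ℕ → ℕ) → Set
CondII 𝒰 f = Σ (ℕ → ℕ) (λ u →
               (∀ n → u n < u (suc n)) ×
               𝒰 (λ m → ∃ (λ n → u n ≡ m)) ×
               (∀ n → f (u n) < u (suc n) ∸ u n))

-- (ii) ⇒ (i). If g x ≤ x on a set in 𝒰, quasi-selectivity applies to g directly.
-- Otherwise g x > x on a set in 𝒰, and at every such uₙ the nondecreasing function
-- y ↦ max { g uⱼ : uⱼ ≤ y } takes the value g uₙ, because for j < n
-- g uⱼ ≤ f uⱼ < uⱼ₊₁ ≤ uₙ < g uₙ.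
--
-- (i) ⇒ (ii). Cut ℕ into consecutive blocks [aₖ, aₖ₊₁) of length f aₖ + 1 and let
-- g m = aₖ₊₁ − m − 1 for m in block k, so g ≤ f. Since g is strictly decreasing on each
-- block, a nondecreasing h agrees with g at most once per block. Taking blocks of one
-- parity, the agreement points lying in them form a set in 𝒰, and any choice of one
-- point from each block of that parity is separated by a whole block, whose length
-- exceeds f at the earlier point.
module Submission where

open import Defs
open import Data.Nat using (ℕ; zero; suc; _+_; _*_; _∸_; _≤_; _<_; _⊔_; _⊓_; z≤n; s≤s; z<s; _≤?_; _<?_; _≟_; _%_; _/_)
open import Data.Nat.Properties
open import Data.Nat.DivMod using (m≡m%n+[m/n]*n; m%n<n)
open import Data.Product using (Σ; ∃; _×_; _,_)
open import Data.Sum using (inj₁; inj₂)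
open import Data.Empty using (⊥-elim)
open import Function using (_∘_)
open import Relation.Nullary using (Dec; yes; no)
open import Relation.Nullary.Decidable using (_×-dec_)
open import Relation.Binary.Definitions using (tri<; tri≈; tri>)
open import Relation.Binary.PropositionalEquality using (_≡_; _≢_; refl; sym; trans; cong; subst₂)

nondecreasing-suc : ∀ {s : ℕ → ℕ} → (∀ n → s n ≤ s (suc n)) → Nondecreasing s
nondecreasing-suc s-step .0 zero z≤n = ≤-refl
nondecreasing-suc s-step m (suc n) m≤1+n with m≤n⇒m<n∨m≡n m≤1+n
... | inj₁ (s≤s m≤n) = ≤-trans (nondecreasing-suc s-step m n m≤n) (s-step n)
... | inj₂ refl      = ≤-refl

module StrictlyIncreasing {s : ℕ → ℕ} (s-inc : ∀ n → s n < s (suc n)) where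

  s-mono-≤ : Nondecreasing s
  s-mono-≤ = nondecreasing-suc (<⇒≤ ∘ s-inc)

  -- block y is the largest k with s k ≤ y, and 0 when y < s 0.
  block : ℕ → ℕ
  block zero = zero
  block (suc y) with s (suc (block y)) ≤? suc y
  ... | yes _ = suc (block y)
  ... | no _  = block y

  s-block≤ : ∀ y → s (block y) ≤ s 0 ⊔ y
  s-block≤ zero = m≤m⊔n (s 0) 0
  s-block≤ (suc y) with s (suc (block y)) ≤? suc y
  ... | yes s≤1+y = ≤-trans s≤1+y (m≤n⊔m (s 0) (suc y))
  ... | no _      = ≤-trans (s-block≤ y) (⊔-monoʳ-≤ (s 0) (n≤1+n y))

  <-s-suc-block : ∀ y → y < s (suc (block y))
  <-s-suc-block zero = ≤-<-trans z≤n (s-inc 0)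
  <-s-suc-block (suc y) with s (suc (block y)) ≤? suc y
  ... | yes _    = ≤-<-trans (<-s-suc-block y) (s-inc _)
  ... | no s≰1+y = ≰⇒> s≰1+y

  block-unique : ∀ {k y} → s k ≤ y → y < s (suc k) → block y ≡ k
  block-unique {k} {y} sk≤y y<s[1+k] with <-cmp (block y) k
  ... | tri≈ _ b≡k _ = b≡k
  ... | tri< b<k _ _ = ⊥-elim (<⇒≱ (<-s-suc-block y) (≤-trans (s-mono-≤ _ _ b<k) sk≤y))
  ... | tri> _ _ k<b = ⊥-elim (<⇒≱ y<s[1+k] (begin
    s (suc k)   ≤⟨ s-mono-≤ _ _ k<b ⟩
    s (block y) ≤⟨ s-block≤ y ⟩
    s 0 ⊔ y     ≡⟨ m≤n⇒m⊔n≡n (≤-trans (s-mono-≤ 0 k z≤n) sk≤y) ⟩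
    y           ∎))
    where open ≤-Reasoning

  block-s : ∀ n → block (s n) ≡ n
  block-s n = block-unique ≤-refl (s-inc n)

  block-mono : Nondecreasing block
  block-mono = nondecreasing-suc block-step
    where
    block-step : ∀ y → block y ≤ block (suc y)
    block-step y with s (suc (block y)) ≤? suc y
    ... | yes _ = n≤1+n (block y)
    ... | no _  = ≤-refl

  block-<⇒< : ∀ {x y} → block x < block y → x < y
  block-<⇒< {x} {y} bx<by with x <? y
  ... | yes x<y = x<y
  ... | no x≮y  = ⊥-elim (<⇒≱ bx<by (block-mono y x (≮⇒≥ x≮y)))

maxUpTo : (ℕ → ℕ) → ℕ → ℕ
maxUpTo t zero    = t zero
maxUpTo t (suc k) = maxUpTo t k ⊔ t (suc k)

maxUpTo-mono : ∀ t → Nondecreasing (maxUpTo t)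
maxUpTo-mono t = nondecreasing-suc λ k → m≤m⊔n (maxUpTo t k) (t (suc k))

≤-maxUpTo : ∀ t {j k} → j ≤ k → t j ≤ maxUpTo t k
≤-maxUpTo t {j} {k} j≤k = ≤-trans (t≤maxUpTo j) (maxUpTo-mono t j k j≤k)
  where
  t≤maxUpTo : ∀ k → t k ≤ maxUpTo t k
  t≤maxUpTo zero    = ≤-refl
  t≤maxUpTo (suc k) = m≤n⊔m (maxUpTo t k) (t (suc k))

maxUpTo-lub : ∀ t {k c} → (∀ {j} → j ≤ k → t j ≤ c) → maxUpTo t k ≤ c
maxUpTo-lub t {zero}  t≤c = t≤c z≤n
maxUpTo-lub t {suc k} t≤c = ⊔-lub (maxUpTo-lub t (t≤c ∘ m≤n⇒m≤1+n)) (t≤c ≤-refl)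

maxUpTo≡last : ∀ t {k} → (∀ {j} → j < k → t j ≤ t k) → maxUpTo t k ≡ t k
maxUpTo≡last t {k} earlier≤ = ≤-antisym (maxUpTo-lub t t≤tk) (≤-maxUpTo t ≤-refl)
  where
  t≤tk : ∀ {j} → j ≤ k → t j ≤ t k
  t≤tk j≤k with m≤n⇒m<n∨m≡n j≤k
  ... | inj₁ j<k = earlier≤ j<k
  ... | inj₂ refl = ≤-refl

%2≢0⇒%2≡1 : ∀ n → n % 2 ≢ 0 → n % 2 ≡ 1
%2≢0⇒%2≡1 n n%2≢0 with n % 2 | m%n<n n 2
... | zero        | _                 = ⊥-elim (n%2≢0 refl)
... | suc zero    | _                 = refl
... | suc (suc _) | s≤s (s≤s ())

m/2*2+p≡m : ∀ m {p} → m % 2 ≡ p → m / 2 * 2 + p ≡ m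
m/2*2+p≡m m refl = trans (+-comm (m / 2 * 2) (m % 2)) (sym (m≡m%n+[m/n]*n m 2))

module _ {𝒰 : Family} (𝒰-ultra : IsUltrafilter 𝒰) where
  open IsUltrafilter 𝒰-ultra

  ∩-upward : ∀ {A B C : ℕ → Set} → 𝒰 A → 𝒰 B → (∀ n → A n → B n → C n) → 𝒰 C
  ∩-upward A∈𝒰 B∈𝒰 A∩B⊆C = upward _ _ (inter _ _ A∈𝒰 B∈𝒰) λ n (An , Bn) → A∩B⊆C n An Bn

  parityClass : ∀ (q : ℕ → ℕ) → ∃ λ p → 𝒰 (λ m → q m % 2 ≡ p)
  parityClass q with ultra (λ m → q m % 2 ≡ 0)
  ... | inj₁ even = 0 , even
  ... | inj₂ odd  = 1 , upward _ _ odd λ m → %2≢0⇒%2≡1 (q m)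

module _ {𝒰 : Family} (qs : IsQuasiSelective 𝒰) where
  open IsQuasiSelective qs
  open IsUltrafilter ultrafilter using (ultra)

  quasiSelective-≤id : ∀ g → 𝒰 (λ n → g n ≤ n) → Σ (ℕ → ℕ) λ h → Nondecreasing h × (h ≡[ 𝒰 ] g)
  quasiSelective-≤id g g≤id with quasiSel (λ n → g n ⊓ n) (λ n → m⊓n≤n (g n) n)
  ... | h , h-mono , g⊓id≡h = h , h-mono ,
    ∩-upward ultrafilter g≤id g⊓id≡h λ n gn≤n g⊓n≡hn → trans (sym g⊓n≡hn) (m≤n⇒m⊓n≡m gn≤n)

  condII⇒condI : ∀ {f} → CondII 𝒰 f → CondI 𝒰 f
  condII⇒condI {f} (u , u-inc , U∈𝒰 , gap) g g≤f with ultra (λ n → g n ≤ n)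
  ... | inj₁ g≤id = quasiSelective-≤id g g≤id
  ... | inj₂ g≰id = stepMax , stepMax-mono ,
    ∩-upward ultrafilter U∈𝒰 g≰id λ { _ (n , refl) g≰u → stepMax-at-u n (≰⇒> g≰u) }
    where
    open StrictlyIncreasing u-inc

    stepMax : ℕ → ℕ
    stepMax = maxUpTo (g ∘ u) ∘ block

    stepMax-mono : Nondecreasing stepMax
    stepMax-mono x y x≤y = maxUpTo-mono (g ∘ u) _ _ (block-mono x y x≤y)

    g-u<u : ∀ {j n} → j < n → g (u j) < u n
    g-u<u {j} {n} j<n = begin-strict
      g (u j)          ≤⟨ g≤f (u j) ⟩
      f (u j)          <⟨ gap j ⟩
      u (suc j) ∸ u j  ≤⟨ m∸n≤m (u (suc j)) (u j) ⟩
      u (suc j)        ≤⟨ s-mono-≤ (suc j) n j<n ⟩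
      u n              ∎
      where open ≤-Reasoning

    stepMax-at-u : ∀ n → u n < g (u n) → stepMax (u n) ≡ g (u n)
    stepMax-at-u n u<g = trans (cong (maxUpTo (g ∘ u)) (block-s n))
                               (maxUpTo≡last (g ∘ u) λ j<n → <⇒≤ (<-trans (g-u<u j<n) u<g))

module _ {f : ℕ → ℕ} (f-mono : Nondecreasing f) where

  blockStart : ℕ → ℕ
  blockStart zero    = 0
  blockStart (suc k) = blockStart k + suc (f (blockStart k))

  blockStart-inc : ∀ k → blockStart k < blockStart (suc k)
  blockStart-inc k = m<m+n (blockStart k) z<s

  open StrictlyIncreasing blockStart-inc

  leftInBlock : ℕ → ℕ
  leftInBlock m = blockStart (suc (block m)) ∸ suc m

  leftInBlock≤f : ∀ m → leftInBlock m ≤ f m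
  leftInBlock≤f m = begin
    blockStart (suc k) ∸ suc m   ≤⟨ ∸-monoʳ-≤ (blockStart (suc k)) (s≤s (s-block≤ m)) ⟩
    blockStart (suc k) ∸ suc b   ≡⟨ cong (_∸ suc b) (+-suc b (f b)) ⟩
    suc b + f b ∸ suc b          ≡⟨ m+n∸m≡n (suc b) (f b) ⟩
    f b                          ≤⟨ f-mono _ _ (s-block≤ m) ⟩
    f m                          ∎
    where
    open ≤-Reasoning
    k = block m
    b = blockStart k

  leftInBlock-decreasing : ∀ {x y} → block x ≡ block y → x < y → leftInBlock y < leftInBlock x
  leftInBlock-decreasing {x} {y} bx≡by x<y rewrite bx≡by =
    ∸-monoʳ-< (s≤s x<y) (<-s-suc-block y)

  f<∸-over-block : ∀ {x y} → suc (block x) < block y → f x < y ∸ x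
  f<∸-over-block {x} {y} 1+bx<by = begin-strict
    f x                          ≤⟨ f-mono _ _ (<⇒≤ x<b) ⟩
    f b                          <⟨ n<1+n (f b) ⟩
    suc (f b)                    ≡⟨ m+n∸m≡n b (suc (f b)) ⟨
    blockStart (suc k) ∸ b       ≤⟨ ∸-mono (≤-trans (s-mono-≤ _ _ 1+bx<by) (s-block≤ y)) (<⇒≤ x<b) ⟩
    y ∸ x                        ∎
    where
    open ≤-Reasoning
    k = suc (block x)
    b = blockStart k
    x<b : x < b
    x<b = <-s-suc-block x

  module Agreement {h : ℕ → ℕ} (h-mono : Nondecreasing h) where

    Agree : ℕ → Set
    Agree m = h m ≡ leftInBlock m

    agree-≤ : ∀ {x y} → Agree x → Agree y → x ≤ y → leftInBlock x ≤ leftInBlock y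
    agree-≤ {x} {y} hx hy x≤y = subst₂ _≤_ hx hy (h-mono x y x≤y)

    agree-unique : ∀ {x y} → block x ≡ block y → Agree x → Agree y → x ≡ y
    agree-unique bx≡by hx hy with <-cmp _ _
    ... | tri≈ _ x≡y _ = x≡y
    ... | tri< x<y _ _ = ⊥-elim (<⇒≱ (leftInBlock-decreasing bx≡by x<y) (agree-≤ hx hy (<⇒≤ x<y)))
    ... | tri> _ _ y<x = ⊥-elim (<⇒≱ (leftInBlock-decreasing (sym bx≡by) y<x) (agree-≤ hy hx (<⇒≤ y<x)))

    agreementIn? : ∀ k → Dec (∃ λ m → m < blockStart (suc k) × (block m ≡ k × Agree m))
    agreementIn? k = anyUpTo? (λ m → block m ≟ k ×-dec h m ≟ leftInBlock m) (blockStart (suc k))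

    pick : ℕ → ℕ
    pick k with agreementIn? k
    ... | yes (m , _) = m
    ... | no _        = blockStart k

    block-pick : ∀ k → block (pick k) ≡ k
    block-pick k with agreementIn? k
    ... | yes (_ , _ , bm≡k , _) = bm≡k
    ... | no _                   = block-s k

    pick-agree : ∀ {m} → Agree m → pick (block m) ≡ m
    pick-agree {m} hm with agreementIn? (block m)
    ... | yes (x , _ , bx≡bm , hx) = agree-unique bx≡bm hx hm
    ... | no none                  = ⊥-elim (none (m , <-s-suc-block m , refl , hm))

  condI⇒condII : ∀ {𝒰} → IsUltrafilter 𝒰 → CondI 𝒰 f → CondII 𝒰 f
  condI⇒condII {𝒰} 𝒰-ultra condI
    with condI leftInBlock leftInBlock≤f | parityClass 𝒰-ultra block
  ... | h , h-mono , agree∈𝒰 | p , parity∈𝒰 =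
    u , u-inc , U∈𝒰 , λ n → f<∸-over-block (block-u-skips n)
    where
    open Agreement h-mono

    u : ℕ → ℕ
    u n = pick (n * 2 + p)

    block-u-skips : ∀ n → suc (block (u n)) < block (u (suc n))
    block-u-skips n rewrite block-pick (n * 2 + p) | block-pick (suc n * 2 + p) = ≤-refl

    u-inc : ∀ n → u n < u (suc n)
    u-inc n = block-<⇒< (<-trans (n<1+n _) (block-u-skips n))

    U∈𝒰 : 𝒰 (λ m → ∃ λ n → u n ≡ m)
    U∈𝒰 = ∩-upward 𝒰-ultra parity∈𝒰 agree∈𝒰 λ m bm%2≡p hm →
      block m / 2 , trans (cong pick (m/2*2+p≡m (block m) bm%2≡p)) (pick-agree hm)

theorem1p4 : (𝒰 : Family) → IsQuasiSelective 𝒰 → (f : ℕ → ℕ) → Nondecreasing f →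
    ((CondI 𝒰 f → CondII 𝒰 f) × (CondII 𝒰 f → CondI 𝒰 f))
theorem1p4 𝒰 qs f f-mono = condI⇒condII f-mono (IsQuasiSelective.ultrafilter qs) , condII⇒condI qs
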